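{- Let $k\geq 3$. For every $c>0$ there exists $q_c\in(0,1)$ such that, with probability $1-o(1)$ as $n\to\infty$, a random instance $\Phi$ of 1-in-$k$ SAT on $n$ variables with clause/variable ratio $c$ has no pair of satisfying assignments $A,B$ with $\mathrm{overlap}(A,B)<q_c$.
   Context: An instance of 1-in-$k$ SAT is a propositional formula in clausal form over variables $x_1,\dots,x_n$ in which every clause consists of exactly $k$ literals on $k$ distinct variables; a satisfying assignment makes exactly one literal true in every clause. A random instance with clause/variable ratio $c$ consists of $cn$ clauses chosen independently and uniformly among the $2^k\binom{n}{k}$ possible clauses (equivalently, for monotone properties asymptotically, each possible clause included independently with a probability $p$ calibrated so that the expected number of clauses is $cn$). The overlap of two assignments is $\mathrm{overlap}(A,B)=|\{i:A(x_i)=B(x_i)\}|/n$.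
   Formalization: The clause/variable ratio c ranges over the positive rationals. -}

module Defs where

open import Data.Nat using (ℕ; zero; suc)
open import Data.Bool using (Bool; true; false; _∧_; _∨_; not; _xor_; if_then_else_)
open import Data.Fin using (Fin)
open import Data.Fin.Properties using (_≟_)
open import Data.Product using (_×_; _,_)
open import Data.List using (List; []; _∷_; concatMap; map; filterᵇ; length; allFin)
open import Data.Bool.ListAction using (all; any)
open import Data.Vec using (Vec; []; _∷_; lookup; toList)
open import Data.Integer using (+_; ∣_∣)
open import Data.Rational using (ℚ; _/_; 0ℚ; _<_; _*_; floor)
open import Data.Rational.Properties using (_<?_)
open import Relation.Nullary.Decidable using (isYes)

-- A literal over variables x_0..x_{n-1}: (variable , polarity);
-- polarity true = positive literal x_i, false = negated literal ¬x_i.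
Literal : ℕ → Set
Literal n = Fin n × Bool

Assignment : ℕ → Set
Assignment n = Vec Bool n

-- A clause is represented as an ordered k-tuple of literals on k distinct
-- variables.  Each (unordered) clause corresponds to exactly k! tuples, so
-- the uniform distribution on tuples induces the uniform distribution on the
-- 2^k (n choose k) clauses.
RawClause : ℕ → ℕ → Set
RawClause k n = Vec (Literal n) k

litTrue : ∀ {n} → Assignment n → Literal n → Bool
litTrue A (i , b) = not (lookup A i xor b)

numTrue : ∀ {k n} → Assignment n → RawClause k n → ℕ
numTrue A []       = 0
numTrue A (l ∷ ls) = if litTrue A l then suc (numTrue A ls) else numTrue A ls

isOne : ℕ → Bool
isOne (suc zero) = true
isOne _          = false

satClause : ∀ {k n} → Assignment n → RawClause k n → Bool
satClause A cl = isOne (numTrue A cl)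

Instance : ℕ → ℕ → ℕ → Set
Instance k n m = Vec (RawClause k n) m

satisfies : ∀ {k n m} → Assignment n → Instance k n m → Bool
satisfies A Φ = all (satClause A) (toList Φ)

agree : ∀ {n} → Assignment n → Assignment n → ℕ
agree []       []       = 0
agree (a ∷ u) (b ∷ w) = if not (a xor b) then suc (agree u w) else agree u w

-- overlap of A and B: (number of agreeing variables) / n ; set to 0 when n = 0
overlapOf : ∀ {n} → Assignment n → Assignment n → ℚ
overlapOf {zero}  A B = 0ℚ
overlapOf {suc n} A B = (+ agree A B) / suc n

allAssignments : (n : ℕ) → List (Assignment n)
allAssignments zero    = [] ∷ []
allAssignments (suc n) = concatMap (λ v → (true ∷ v) ∷ (false ∷ v) ∷ []) (allAssignments n)

allLiterals : (n : ℕ) → List (Literal n)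
allLiterals n = concatMap (λ i → (i , true) ∷ (i , false) ∷ []) (allFin n)

vecsOver : ∀ {A : Set} → List A → (m : ℕ) → List (Vec A m)
vecsOver xs zero    = [] ∷ []
vecsOver xs (suc m) = concatMap (λ x → map (x ∷_) (vecsOver xs m)) xs

distinctVars : ∀ {k n} → RawClause k n → Bool
distinctVars []             = true
distinctVars ((i , _) ∷ ls) =
  all (λ l → not (isYes (i ≟ Data.Product.proj₁ l))) (toList ls) ∧ distinctVars ls

allClauses : (k n : ℕ) → List (RawClause k n)
allClauses k n = filterᵇ distinctVars (vecsOver (allLiterals n) k)

-- all instances consisting of m clauses chosen independently and uniformly
allInstances : (k n m : ℕ) → List (Instance k n m)
allInstances k n m = vecsOver (allClauses k n) m

numClauses : ℚ → ℕ → ℕ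
numClauses c n = ∣ floor (c * ((+ n) / 1)) ∣

hasClosePair : ∀ {k n m} → ℚ → Instance k n m → Bool
hasClosePair {n = n} q Φ =
  any (λ A → any (λ B → satisfies A Φ ∧ satisfies B Φ ∧ isYes (overlapOf A B <? q))
                 (allAssignments n))
      (allAssignments n)

badCount : (k n : ℕ) → ℚ → ℚ → ℕ
badCount k n c q = length (filterᵇ (hasClosePair q) (allInstances k n (numClauses c n)))

totalCount : (k n : ℕ) → ℚ → ℕ
totalCount k n c = length (allInstances k n (numClauses c n))

module Submission where

-- If A and B both 1-in-k satisfy a clause, the clause contains a variable on which A and B
-- agree: otherwise each of its k literals is true under exactly one of them, and 1 + 1 ≠ k.
-- When A and B agree on fewer than q n variables, a uniformly random clause meets their
-- agreement set with probability less than 2 k q (tuples repeating a variable are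
-- negligible once n ≥ 2k²). Writing c = (1 + a) / b and q = 1 / (2 + 2k 8^b), a fixed pair
-- is therefore compatible with all m = ⌊c n⌋ clauses with probability at most 8^(-b m), and the
-- union bound over the 4^n pairs gives 4^n 8^(-b m) → 0 because 3 b m ≥ 3 n - 3 b.
-- All probabilities are exact counts over the enumerated instance space, and every inequality
-- is multiplied out so that it stays in ℕ.

open import Defs

module Counting where

  open import Data.Bool using (Bool; true; false; not; _∧_; _∨_; if_then_else_)
  open import Data.Bool.Properties using (∧-conicalˡ; ∧-conicalʳ)
  open import Data.Bool.ListAction using (all; any)
  open import Data.List using (List; []; _∷_; _++_; map; concatMap; filterᵇ; length)
  open import Data.Nat.ListAction using (sum)
  open import Data.List.Properties using (map-cong)
  open import Data.Nat
  open import Data.Nat.Properties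
  open import Data.Nat.Tactic.RingSolver using (solve-∀)
  open import Data.Vec using (Vec; toList) renaming (_∷_ to _∷ᵥ_)
  open import Function using (_∘_)
  open import Relation.Binary.PropositionalEquality

  private variable
    A B : Set

  count : (A → Bool) → List A → ℕ
  count p xs = length (filterᵇ p xs)

  not-all-not-∧ : (p : A → Bool) → ∀ xs b → not (all (not ∘ p) xs ∧ b) ≡ any p xs ∨ not b
  not-all-not-∧ p []       b = refl
  not-all-not-∧ p (x ∷ xs) b with p x
  ... | true  = refl
  ... | false = not-all-not-∧ p xs b

  all-mono₂ : (p q r : A → Bool) → (∀ x → p x ≡ true → q x ≡ true → r x ≡ true) →
              ∀ xs → all p xs ≡ true → all q xs ≡ true → all r xs ≡ true
  all-mono₂ p q r pq⇒r []       _   _   = refl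
  all-mono₂ p q r pq⇒r (x ∷ xs) pxs qxs
    rewrite pq⇒r x (∧-conicalˡ (p x) _ pxs) (∧-conicalˡ (q x) _ qxs) =
    all-mono₂ p q r pq⇒r xs (∧-conicalʳ (p x) _ pxs) (∧-conicalʳ (q x) _ qxs)

  count-mono : (p q : A → Bool) → (∀ x → p x ≡ true → q x ≡ true) →
               ∀ xs → count p xs ≤ count q xs
  count-mono p q p⇒q [] = z≤n
  count-mono p q p⇒q (x ∷ xs) with p x in px | q x in qx
  ... | true  | true  = s≤s (count-mono p q p⇒q xs)
  ... | false | true  = m≤n⇒m≤1+n (count-mono p q p⇒q xs)
  ... | false | false = count-mono p q p⇒q xs
  ... | true  | false with () ← trans (sym (p⇒q x px)) qx

  count-cong : (p q : A → Bool) → (∀ x → p x ≡ q x) → ∀ xs → count p xs ≡ count q xs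
  count-cong p q p≗q xs = ≤-antisym (count-mono p q (λ x px → trans (sym (p≗q x)) px) xs)
                                    (count-mono q p (λ x qx → trans (p≗q x) qx) xs)

  count-false : ∀ (xs : List A) → count (λ _ → false) xs ≡ 0
  count-false []       = refl
  count-false (x ∷ xs) = count-false xs

  count-true : ∀ (xs : List A) → count (λ _ → true) xs ≡ length xs
  count-true []       = refl
  count-true (x ∷ xs) = cong suc (count-true xs)

  count-const : (b : Bool) → ∀ (xs : List A) → count (λ _ → b) xs ≡ (if b then length xs else 0)
  count-const true  = count-true
  count-const false = count-false

  count-∧ˡ : (b : Bool) (q : A → Bool) → ∀ xs → count (λ x → b ∧ q x) xs ≡ (if b then count q xs else 0)
  count-∧ˡ true  q xs = refl
  count-∧ˡ false q xs = count-false xs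

  count-∨ : (p q : A → Bool) → ∀ xs →
            count (λ x → p x ∨ q x) xs ≤ count p xs + count q xs
  count-∨ p q [] = z≤n
  count-∨ p q (x ∷ xs) with p x | q x
  ... | true  | true  = s≤s (≤-trans (count-∨ p q xs) (≤-trans (n≤1+n _) (≤-reflexive (sym (+-suc _ _)))))
  ... | true  | false = s≤s (count-∨ p q xs)
  ... | false | true  = ≤-trans (s≤s (count-∨ p q xs)) (≤-reflexive (sym (+-suc _ _)))
  ... | false | false = count-∨ p q xs

  count-+-count-not : (p : A → Bool) → ∀ xs → count p xs + count (not ∘ p) xs ≡ length xs
  count-+-count-not p [] = refl
  count-+-count-not p (x ∷ xs) with p x
  ... | true  = cong suc (count-+-count-not p xs)
  ... | false = trans (+-suc _ _) (cong suc (count-+-count-not p xs))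

  count-≤-count-∷ : (p : A → Bool) (x : A) → ∀ xs → count p xs ≤ count p (x ∷ xs)
  count-≤-count-∷ p x xs with p x
  ... | true  = n≤1+n _
  ... | false = ≤-refl

  count-filterᵇ : (p q : A → Bool) → ∀ xs → count p (filterᵇ q xs) ≤ count p xs
  count-filterᵇ p q [] = z≤n
  count-filterᵇ p q (x ∷ xs) with q x
  ... | false = ≤-trans (count-filterᵇ p q xs) (count-≤-count-∷ p x xs)
  ... | true with p x
  ...   | true  = s≤s (count-filterᵇ p q xs)
  ...   | false = count-filterᵇ p q xs

  count-++ : (p : A → Bool) → ∀ xs ys → count p (xs ++ ys) ≡ count p xs + count p ys
  count-++ p []       ys = refl
  count-++ p (x ∷ xs) ys with p x
  ... | true  = cong suc (count-++ p xs ys)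
  ... | false = count-++ p xs ys

  count-map : (p : B → Bool) (f : A → B) → ∀ xs → count p (map f xs) ≡ count (p ∘ f) xs
  count-map p f [] = refl
  count-map p f (x ∷ xs) with p (f x)
  ... | true  = cong suc (count-map p f xs)
  ... | false = count-map p f xs

  count-concatMap : (p : B → Bool) (f : A → List B) → ∀ xs →
                    count p (concatMap f xs) ≡ sum (map (count p ∘ f) xs)
  count-concatMap p f []       = refl
  count-concatMap p f (x ∷ xs) =
    trans (count-++ p (f x) (concatMap f xs)) (cong (count p (f x) +_) (count-concatMap p f xs))

  count-any : (r : A → B → Bool) (ys : List B) → ∀ xs →
              count (λ x → any (r x) ys) xs ≤ sum (map (λ y → count (λ x → r x y) xs) ys)
  count-any r []       xs = ≤-reflexive (count-false xs)
  count-any r (y ∷ ys) xs = ≤-trans (count-∨ (λ x → r x y) (λ x → any (r x) ys) xs)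
                                    (+-monoʳ-≤ _ (count-any r ys xs))

  sum-mono : (f g : A → ℕ) → (∀ x → f x ≤ g x) → ∀ xs → sum (map f xs) ≤ sum (map g xs)
  sum-mono f g f≤g []       = z≤n
  sum-mono f g f≤g (x ∷ xs) = +-mono-≤ (f≤g x) (sum-mono f g f≤g xs)

  sum-const : (K : ℕ) → ∀ (xs : List A) → sum (map (λ _ → K) xs) ≡ length xs * K
  sum-const K []       = refl
  sum-const K (x ∷ xs) = cong (K +_) (sum-const K xs)

  sum-*ʳ : (f : A → ℕ) (K : ℕ) → ∀ xs → sum (map (λ x → f x * K) xs) ≡ sum (map f xs) * K
  sum-*ʳ f K []       = refl
  sum-*ʳ f K (x ∷ xs) = trans (cong (f x * K +_) (sum-*ʳ f K xs)) (sym (*-distribʳ-+ K (f x) _))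

  sum-+ : (f g : A → ℕ) → ∀ xs → sum (map (λ x → f x + g x) xs) ≡ sum (map f xs) + sum (map g xs)
  sum-+ f g []       = refl
  sum-+ f g (x ∷ xs) = trans (cong (f x + g x +_) (sum-+ f g xs)) (+-assoc-swap (f x) (g x) _ _)
    where
    +-assoc-swap : ∀ a b c d → a + b + (c + d) ≡ a + c + (b + d)
    +-assoc-swap = solve-∀

  sum-*ʳ-≤ : (f : A → ℕ) (K M : ℕ) → (∀ x → f x * K ≤ M) → ∀ xs → sum (map f xs) * K ≤ length xs * M
  sum-*ʳ-≤ f K M bound xs = begin
    sum (map f xs) * K              ≡⟨ sum-*ʳ f K xs ⟨
    sum (map (λ x → f x * K) xs)    ≤⟨ sum-mono _ _ bound xs ⟩
    sum (map (λ _ → M) xs)          ≡⟨ sum-const M xs ⟩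
    length xs * M                   ∎
    where open ≤-Reasoning

  sum-if : (p : A → Bool) (K : ℕ) → ∀ xs →
           sum (map (λ x → if p x then K else 0) xs) ≡ count p xs * K
  sum-if p K []       = refl
  sum-if p K (x ∷ xs) with p x
  ... | true  = cong (K +_) (sum-if p K xs)
  ... | false = sum-if p K xs

  module _ (xs : List A) where

    count-vecsOver-suc : ∀ {m} (P : Vec A (suc m) → Bool) → count P (vecsOver xs (suc m)) ≡
                         sum (map (λ x → count (P ∘ (x ∷ᵥ_)) (vecsOver xs m)) xs)
    count-vecsOver-suc {m} P = trans (count-concatMap P (λ x → map (x ∷ᵥ_) (vecsOver xs m)) xs)
                                     (cong sum (map-cong (λ x → count-map P (x ∷ᵥ_) (vecsOver xs m)) xs))

    length-vecsOver : ∀ m → length (vecsOver xs m) ≡ length xs ^ m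
    length-vecsOver zero    = refl
    length-vecsOver (suc m) = begin
      length (vecsOver xs (suc m))                           ≡⟨ count-true (vecsOver xs (suc m)) ⟨
      count (λ _ → true) (vecsOver xs (suc m))               ≡⟨ count-vecsOver-suc (λ _ → true) ⟩
      sum (map (λ _ → count (λ _ → true) (vecsOver xs m)) xs) ≡⟨ sum-const _ xs ⟩
      length xs * count (λ _ → true) (vecsOver xs m)         ≡⟨ cong (length xs *_) (trans (count-true (vecsOver xs m)) (length-vecsOver m)) ⟩
      length xs * length xs ^ m                              ∎
      where open ≡-Reasoning

    count-all-vecsOver : (p : A → Bool) → ∀ m → count (all p ∘ toList) (vecsOver xs m) ≡ count p xs ^ m
    count-all-vecsOver p zero    = refl
    count-all-vecsOver p (suc m) = begin
      count (all p ∘ toList) (vecsOver xs (suc m))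
        ≡⟨ count-vecsOver-suc (all p ∘ toList) ⟩
      sum (map (λ x → count (λ v → p x ∧ all p (toList v)) (vecsOver xs m)) xs)
        ≡⟨ cong sum (map-cong (λ x → count-∧ˡ (p x) (all p ∘ toList) (vecsOver xs m)) xs) ⟩
      sum (map (λ x → if p x then count (all p ∘ toList) (vecsOver xs m) else 0) xs)
        ≡⟨ sum-if p _ xs ⟩
      count p xs * count (all p ∘ toList) (vecsOver xs m)
        ≡⟨ cong (count p xs *_) (count-all-vecsOver p m) ⟩
      count p xs * count p xs ^ m ∎
      where open ≡-Reasoning

    -- A union bound over the m positions, multiplied through by length xs to avoid division.
    count-any-vecsOver : (p : A → Bool) → ∀ m →
      count (any p ∘ toList) (vecsOver xs m) * length xs ≤ m * count p xs * length xs ^ m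
    count-any-vecsOver p zero    = z≤n
    count-any-vecsOver p (suc m) = begin
      count (any p ∘ toList) (vecsOver xs (suc m)) * X ≤⟨ *-monoˡ-≤ X recurrence ⟩
      (f * X ^ m + X * Aₘ) * X                        ≡⟨ rearrange f X (X ^ m) Aₘ ⟩
      f * X ^ m * X + X * (Aₘ * X)                    ≤⟨ +-monoʳ-≤ _ (*-monoʳ-≤ X (count-any-vecsOver p m)) ⟩
      f * X ^ m * X + X * (m * f * X ^ m)             ≡⟨ collect f X (X ^ m) m ⟩
      suc m * f * (X * X ^ m)                         ∎
      where
      open ≤-Reasoning
      X  = length xs
      f  = count p xs
      Aₘ = count (any p ∘ toList) (vecsOver xs m)

      rearrange : ∀ f X Y A → (f * Y + X * A) * X ≡ f * Y * X + X * (A * X)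
      rearrange = solve-∀
      collect : ∀ f X Y m → f * Y * X + X * (m * f * Y) ≡ suc m * f * (X * Y)
      collect = solve-∀

      recurrence : count (any p ∘ toList) (vecsOver xs (suc m)) ≤ f * X ^ m + X * Aₘ
      recurrence = begin
        count (any p ∘ toList) (vecsOver xs (suc m))
          ≡⟨ count-vecsOver-suc (any p ∘ toList) ⟩
        sum (map (λ x → count (λ v → p x ∨ any p (toList v)) (vecsOver xs m)) xs)
          ≤⟨ sum-mono _ _ (λ x → ≤-trans (count-∨ (λ _ → p x) (any p ∘ toList) (vecsOver xs m))
                                          (≤-reflexive (cong (_+ Aₘ) (count-const (p x) (vecsOver xs m))))) xs ⟩
        sum (map (λ x → (if p x then length (vecsOver xs m) else 0) + Aₘ) xs)
          ≡⟨ sum-+ _ _ xs ⟩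
        sum (map (λ x → if p x then length (vecsOver xs m) else 0) xs) + sum (map (λ _ → Aₘ) xs)
          ≡⟨ cong₂ _+_ (sum-if p _ xs) (sum-const Aₘ xs) ⟩
        f * length (vecsOver xs m) + X * Aₘ
          ≡⟨ cong (λ L → f * L + X * Aₘ) (length-vecsOver m) ⟩
        f * X ^ m + X * Aₘ ∎

module Clauses where

  open Counting
  open import Data.Bool using (Bool; true; false; not; _∧_; _∨_; _xor_; if_then_else_)
  open import Data.Bool.ListAction using (all; any)
  open import Data.Fin using (Fin; zero; suc)
  open import Data.Fin.Properties using (_≟_)
  open import Data.List using ([]; _∷_; map; filterᵇ; length; allFin; tabulate)
  open import Data.List.Properties using (map-cong; map-tabulate; length-tabulate)
  open import Data.Nat.ListAction using (sum)
  open import Data.Nat hiding (_≟_)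
  open import Data.Nat.Properties hiding (_≟_)
  open import Data.Nat.Tactic.RingSolver using (solve-∀)
  open import Data.Product using (_,_; proj₁)
  open import Data.Vec using (toList; lookup) renaming ([] to []ᵥ; _∷_ to _∷ᵥ_)
  open import Function using (_∘_; id)
  open import Relation.Binary.PropositionalEquality
  open import Relation.Nullary.Negation using (contradiction)
  open import Relation.Nullary.Decidable using (isYes; isYes≗does)

  private variable
    k n : ℕ

  count-allFin-suc : (P : Fin (suc n) → Bool) →
                     count P (allFin (suc n)) ≡ count P (zero ∷ []) + count (P ∘ suc) (allFin n)
  count-allFin-suc {n} P = trans (count-++ P (zero ∷ []) (tabulate suc))
    (cong (count P (zero ∷ []) +_) (trans (cong (count P) (sym (map-tabulate id suc))) (count-map P suc (allFin n))))

  count-≟ : (i : Fin n) → count (λ j → isYes (i ≟ j)) (allFin n) ≡ 1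
  count-≟ {suc n} zero    = trans (count-allFin-suc {n} (λ j → isYes (zero ≟ j))) (cong suc (count-false (allFin n)))
  count-≟ {suc n} (suc i) = begin
    count (λ j → isYes (suc i ≟ j)) (allFin (suc n))  ≡⟨ count-allFin-suc (λ j → isYes (suc i ≟ j)) ⟩
    count (λ j → isYes (suc i ≟ suc j)) (allFin n)    ≡⟨ count-cong _ _ isYes-suc≟suc (allFin n) ⟩
    count (λ j → isYes (i ≟ j)) (allFin n)            ≡⟨ count-≟ i ⟩
    1                                                 ∎
    where
    open ≡-Reasoning
    isYes-suc≟suc : ∀ j → isYes (suc i ≟ suc j) ≡ isYes (i ≟ j)
    isYes-suc≟suc j = trans (isYes≗does (suc i ≟ suc j)) (sym (isYes≗does (i ≟ j)))

  agreeAt : Assignment n → Assignment n → Fin n → Bool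
  agreeAt A B i = not (lookup A i xor lookup B i)

  count-agreeAt : (A B : Assignment n) → count (agreeAt A B) (allFin n) ≡ agree A B
  count-agreeAt []ᵥ       []ᵥ       = refl
  count-agreeAt (a ∷ᵥ A) (b ∷ᵥ B) rewrite count-allFin-suc (agreeAt (a ∷ᵥ A) (b ∷ᵥ B)) with not (a xor b)
  ... | true  = cong suc (count-agreeAt A B)
  ... | false = count-agreeAt A B

  count-allLiterals : (P : Fin n → Bool) → count (P ∘ proj₁) (allLiterals n) ≡ count P (allFin n) * 2
  count-allLiterals {n} P = begin
    count (P ∘ proj₁) (allLiterals n)
      ≡⟨ count-concatMap (P ∘ proj₁) (λ i → (i , true) ∷ (i , false) ∷ []) (allFin n) ⟩
    sum (map (λ i → count (P ∘ proj₁) ((i , true) ∷ (i , false) ∷ [])) (allFin n))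
      ≡⟨ cong sum (map-cong bothPolarities (allFin n)) ⟩
    sum (map (λ i → if P i then 2 else 0) (allFin n))
      ≡⟨ sum-if P 2 (allFin n) ⟩
    count P (allFin n) * 2 ∎
    where
    open ≡-Reasoning
    bothPolarities : ∀ i → count (P ∘ proj₁) ((i , true) ∷ (i , false) ∷ []) ≡ (if P i then 2 else 0)
    bothPolarities i = trans (count-map (P ∘ proj₁) (i ,_) (true ∷ false ∷ []))
                             (count-const (P i) (true ∷ false ∷ []))

  length-allLiterals : ∀ n → length (allLiterals n) ≡ 2 * n
  length-allLiterals n = begin
    length (allLiterals n)                   ≡⟨ count-true (allLiterals n) ⟨
    count (λ _ → true) (allLiterals n)       ≡⟨ count-allLiterals {n} (λ _ → true) ⟩
    count (λ _ → true) (allFin n) * 2        ≡⟨ cong (_* 2) (trans (count-true (allFin n)) (length-tabulate {n = n} id)) ⟩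
    n * 2                                    ≡⟨ *-comm n 2 ⟩
    2 * n                                    ∎
    where open ≡-Reasoning

  hitsAgreement : Assignment n → Assignment n → RawClause k n → Bool
  hitsAgreement A B cl = any (agreeAt A B ∘ proj₁) (toList cl)

  numTrue-+-numTrue : (A B : Assignment n) (cl : RawClause k n) → hitsAgreement A B cl ≡ false →
                      numTrue A cl + numTrue B cl ≡ k
  numTrue-+-numTrue A B []ᵥ              _ = refl
  numTrue-+-numTrue A B ((i , b) ∷ᵥ cl) h with lookup A i | lookup B i | b
  ... | true  | true  | _     with () ← h
  ... | false | false | _     with () ← h
  ... | true  | false | true  = cong suc (numTrue-+-numTrue A B cl h)
  ... | true  | false | false = trans (+-suc _ _) (cong suc (numTrue-+-numTrue A B cl h))
  ... | false | true  | true  = trans (+-suc _ _) (cong suc (numTrue-+-numTrue A B cl h))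
  ... | false | true  | false = cong suc (numTrue-+-numTrue A B cl h)

  isOne⇒≡1 : ∀ m → isOne m ≡ true → m ≡ 1
  isOne⇒≡1 1 _ = refl

  satClause⇒hitsAgreement : 3 ≤ k → (A B : Assignment n) (cl : RawClause k n) →
    satClause A cl ≡ true → satClause B cl ≡ true → hitsAgreement A B cl ≡ true
  satClause⇒hitsAgreement {k} 3≤k A B cl satA satB with hitsAgreement A B cl in miss
  ... | true  = refl
  ... | false = contradiction two≡k (<⇒≢ 3≤k)
    where
    two≡k : 2 ≡ k
    two≡k = trans (sym (cong₂ _+_ (isOne⇒≡1 _ satA) (isOne⇒≡1 _ satB))) (numTrue-+-numTrue A B cl miss)

  sameVariable : Literal n → Literal n → Bool
  sameVariable l l′ = isYes (proj₁ l ≟ proj₁ l′)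

  repeatsVariable : RawClause k n → Bool
  repeatsVariable cl = not (distinctVars cl)

  repeatsVariable-∷ : (l : Literal n) (cl : RawClause k n) →
    repeatsVariable (l ∷ᵥ cl) ≡ any (sameVariable l) (toList cl) ∨ repeatsVariable cl
  repeatsVariable-∷ l cl = not-all-not-∧ (sameVariable l) (toList cl) (distinctVars cl)

  module _ (n : ℕ) where

    private
      X : ℕ
      X = length (allLiterals n)

    count-sameVariable : (l : Literal n) → count (sameVariable l) (allLiterals n) ≡ 2
    count-sameVariable l = trans (count-allLiterals (λ j → isYes (proj₁ l ≟ j))) (cong (_* 2) (count-≟ (proj₁ l)))

    count-repeatsVariable : ∀ m → count repeatsVariable (vecsOver (allLiterals n) m) * X ≤ 2 * m * m * X ^ m
    count-repeatsVariable zero    = z≤n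
    count-repeatsVariable (suc m) = begin
      count repeatsVariable (vecsOver (allLiterals n) (suc m)) * X ≤⟨ *-monoˡ-≤ X recurrence ⟩
      sum (map (λ l → Sₗ l + Rₘ) (allLiterals n)) * X            ≡⟨ sum-*ʳ (λ l → Sₗ l + Rₘ) X (allLiterals n) ⟨
      sum (map (λ l → (Sₗ l + Rₘ) * X) (allLiterals n))          ≤⟨ sum-mono _ _ termwise (allLiterals n) ⟩
      sum (map (λ _ → 2 * m * X ^ m + 2 * m * m * X ^ m) (allLiterals n))
                                                                 ≡⟨ sum-const _ (allLiterals n) ⟩
      X * (2 * m * X ^ m + 2 * m * m * X ^ m)                    ≤⟨ expand m X (X ^ m) ⟩
      2 * suc m * suc m * (X * X ^ m)                            ∎
      where
      open ≤-Reasoning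
      Rₘ = count repeatsVariable (vecsOver (allLiterals n) m)
      Sₗ : Literal n → ℕ
      Sₗ l = count (any (sameVariable l) ∘ toList) (vecsOver (allLiterals n) m)

      recurrence : count repeatsVariable (vecsOver (allLiterals n) (suc m)) ≤ sum (map (λ l → Sₗ l + Rₘ) (allLiterals n))
      recurrence = ≤-trans (≤-reflexive (count-vecsOver-suc (allLiterals n) repeatsVariable))
        (sum-mono _ _ (λ l → ≤-trans (≤-reflexive (count-cong _ _ (repeatsVariable-∷ l) (vecsOver (allLiterals n) m)))
                                     (count-∨ (any (sameVariable l) ∘ toList) repeatsVariable (vecsOver (allLiterals n) m)))
                  (allLiterals n))

      termwise : ∀ l → (Sₗ l + Rₘ) * X ≤ 2 * m * X ^ m + 2 * m * m * X ^ m
      termwise l = begin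
        (Sₗ l + Rₘ) * X                                      ≡⟨ *-distribʳ-+ X (Sₗ l) Rₘ ⟩
        Sₗ l * X + Rₘ * X                                    ≤⟨ +-mono-≤ (count-any-vecsOver (allLiterals n) (sameVariable l) m)
                                                                         (count-repeatsVariable m) ⟩
        m * count (sameVariable l) (allLiterals n) * X ^ m + 2 * m * m * X ^ m
                                                             ≡⟨ cong (λ c → m * c * X ^ m + 2 * m * m * X ^ m) (count-sameVariable l) ⟩
        m * 2 * X ^ m + 2 * m * m * X ^ m                    ≡⟨ cong (λ c → c * X ^ m + 2 * m * m * X ^ m) (*-comm m 2) ⟩
        2 * m * X ^ m + 2 * m * m * X ^ m                    ∎

      expand : ∀ m X Y → X * (2 * m * Y + 2 * m * m * Y) ≤ 2 * suc m * suc m * (X * Y)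
      expand m X Y = ≤-trans (m≤m+n _ (2 * m * X * Y + 2 * X * Y)) (≤-reflexive (identity m X Y))
        where
        identity : ∀ m X Y → X * (2 * m * Y + 2 * m * m * Y) + (2 * m * X * Y + 2 * X * Y) ≡ 2 * suc m * suc m * (X * Y)
        identity = solve-∀

    length-allClauses-+-count-repeatsVariable : ∀ k →
      length (allClauses k n) + count repeatsVariable (vecsOver (allLiterals n) k) ≡ X ^ k
    length-allClauses-+-count-repeatsVariable k =
      trans (count-+-count-not distinctVars (vecsOver (allLiterals n) k)) (length-vecsOver (allLiterals n) k)

    count-hitsAgreement : ∀ k (A B : Assignment n) →
      count (hitsAgreement {k = k} A B) (allClauses k n) * X ≤ k * (agree A B * 2) * X ^ k
    count-hitsAgreement k A B = begin
      count (hitsAgreement A B) (allClauses k n) * X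
        ≤⟨ *-monoˡ-≤ X (count-filterᵇ (hitsAgreement A B) distinctVars (vecsOver (allLiterals n) k)) ⟩
      count (hitsAgreement A B) (vecsOver (allLiterals n) k) * X
        ≤⟨ count-any-vecsOver (allLiterals n) (agreeAt A B ∘ proj₁) k ⟩
      k * count (agreeAt A B ∘ proj₁) (allLiterals n) * X ^ k
        ≡⟨ cong (λ c → k * c * X ^ k) (trans (count-allLiterals (agreeAt A B)) (cong (_* 2) (count-agreeAt A B))) ⟩
      k * (agree A B * 2) * X ^ k ∎
      where open ≤-Reasoning

    module _ {k : ℕ} (1≤k : 1 ≤ k) (2k²≤n : 2 * k * k ≤ n) where

      private
        X≡2n : X ≡ 2 * n
        X≡2n = length-allLiterals n

        instance
          k≢0 : NonZero k
          k≢0 = >-nonZero 1≤k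
          2k≢0 : NonZero (2 * k)
          2k≢0 = m*n≢0 2 k
          n≢0 : NonZero n
          n≢0 = >-nonZero (≤-trans 1≤k (≤-trans (m≤n*m k (2 * k)) 2k²≤n))
          X≢0 : NonZero X
          X≢0 = subst NonZero (sym X≡2n) (m*n≢0 2 n)

      -- Tuples repeating a variable make up at most 2k²/(2n) ≤ 1/2 of all literal tuples.
      X^k≤2*length-allClauses : X ^ k ≤ 2 * length (allClauses k n)
      X^k≤2*length-allClauses = +-cancelʳ-≤ (X ^ k) (X ^ k) (2 * C) (begin
        X ^ k + X ^ k        ≡⟨ cong (λ y → y + y) (length-allClauses-+-count-repeatsVariable k) ⟨
        (C + R) + (C + R)    ≡⟨ double C R ⟩
        2 * C + 2 * R        ≤⟨ +-monoʳ-≤ (2 * C) 2R≤X^k ⟩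
        2 * C + X ^ k        ∎)
        where
        open ≤-Reasoning
        C = length (allClauses k n)
        R = count repeatsVariable (vecsOver (allLiterals n) k)
        double : ∀ C R → (C + R) + (C + R) ≡ 2 * C + 2 * R
        double = solve-∀
        2R≤X^k : 2 * R ≤ X ^ k
        2R≤X^k = *-cancelʳ-≤ (2 * R) (X ^ k) X (begin
          2 * R * X                ≡⟨ *-assoc 2 R X ⟩
          2 * (R * X)              ≤⟨ *-monoʳ-≤ 2 (count-repeatsVariable k) ⟩
          2 * (2 * k * k * X ^ k)  ≡⟨ *-assoc 2 (2 * k * k) (X ^ k) ⟨
          2 * (2 * k * k) * X ^ k  ≤⟨ *-monoˡ-≤ (X ^ k) (≤-trans (*-monoʳ-≤ 2 2k²≤n) (≤-reflexive (sym X≡2n))) ⟩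
          X * X ^ k                ≡⟨ *-comm X (X ^ k) ⟩
          X ^ k * X                ∎)

      hitsAgreement-rare : ∀ T (A B : Assignment n) → agree A B * (2 * k * T) < n →
        count (hitsAgreement {k = k} A B) (allClauses k n) * T ≤ length (allClauses k n)
      hitsAgreement-rare T A B close = *-cancelʳ-≤ (H * T) C (2 * k) (begin
        H * T * (2 * k)      ≡⟨ swap H T (2 * k) ⟩
        H * (2 * k * T)      ≤⟨ *-cancelʳ-≤ (H * (2 * k * T)) (k * X ^ k) X H*R*X≤k*X^k*X ⟩
        k * X ^ k            ≤⟨ *-monoʳ-≤ k X^k≤2*length-allClauses ⟩
        k * (2 * C)          ≡⟨ swap′ k C ⟩
        C * (2 * k)          ∎)
        where
        open ≤-Reasoning
        H = count (hitsAgreement {k = k} A B) (allClauses k n)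
        C = length (allClauses k n)
        d = agree A B
        R = 2 * k * T
        swap : ∀ H T K → H * T * K ≡ H * (K * T)
        swap = solve-∀
        swap′ : ∀ k C → k * (2 * C) ≡ C * (2 * k)
        swap′ = solve-∀
        regroup : ∀ H R X → H * R * X ≡ H * X * R
        regroup = solve-∀
        regroup′ : ∀ k d Y R → k * (d * 2) * Y * R ≡ k * Y * (2 * (d * R))
        regroup′ = solve-∀
        H*R*X≤k*X^k*X : H * R * X ≤ k * X ^ k * X
        H*R*X≤k*X^k*X = begin
          H * R * X                  ≡⟨ regroup H R X ⟩
          H * X * R                  ≤⟨ *-monoˡ-≤ R (count-hitsAgreement k A B) ⟩
          k * (d * 2) * X ^ k * R    ≡⟨ regroup′ k d (X ^ k) R ⟩
          k * X ^ k * (2 * (d * R))  ≤⟨ *-monoʳ-≤ (k * X ^ k) (≤-trans (*-monoʳ-≤ 2 (<⇒≤ close)) (≤-reflexive (sym X≡2n))) ⟩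
          k * X ^ k * X              ∎

module FirstMoment where

  open Counting
  open Clauses
  open import Data.Bool using (Bool; true; false; _∧_)
  open import Data.Bool.Properties using (∧-conicalˡ; ∧-conicalʳ; T-≡)
  open import Data.Bool.ListAction using (all; any)
  open import Data.List using (List; []; _∷_; map; length)
  open import Data.Nat.ListAction using (sum)
  open import Function.Bundles using (Equivalence)
  open import Data.Nat
  open import Data.Nat.Properties
  open import Data.Nat.Tactic.RingSolver using (solve-∀)
  open import Data.Rational using (ℚ) renaming (_<_ to _<ℚ_)
  open import Data.Rational.Properties using () renaming (_<?_ to _<ℚ?_)
  open import Data.Vec using (toList) renaming (_∷_ to _∷ᵥ_)
  open import Function using (_∘_)
  open import Relation.Binary.PropositionalEquality
  open import Relation.Nullary.Decidable using (isYes; toWitness)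

  ^-distribʳ-* : ∀ m n o → (m * n) ^ o ≡ m ^ o * n ^ o
  ^-distribʳ-* m n zero    = refl
  ^-distribʳ-* m n (suc o) = trans (cong (m * n *_) (^-distribʳ-* m n o)) (interchange m n (m ^ o) (n ^ o))
    where
    interchange : ∀ a b c d → a * b * (c * d) ≡ a * c * (b * d)
    interchange = solve-∀

  length-allAssignments : ∀ n → length (allAssignments n) ≡ 2 ^ n
  length-allAssignments zero    = refl
  length-allAssignments (suc n) = begin
    length (allAssignments (suc n))                        ≡⟨ count-true (allAssignments (suc n)) ⟨
    count (λ _ → true) (allAssignments (suc n))
      ≡⟨ count-concatMap (λ _ → true) (λ v → (true ∷ᵥ v) ∷ (false ∷ᵥ v) ∷ []) (allAssignments n) ⟩
    sum (map (λ _ → 2) (allAssignments n))                 ≡⟨ sum-const 2 (allAssignments n) ⟩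
    length (allAssignments n) * 2                          ≡⟨ cong (_* 2) (length-allAssignments n) ⟩
    2 ^ n * 2                                              ≡⟨ *-comm (2 ^ n) 2 ⟩
    2 ^ suc n                                              ∎
    where open ≡-Reasoning

  module _ {k n m : ℕ} (3≤k : 3 ≤ k) where

    count-satisfiedByBoth : (A B : Assignment n) →
      count (λ Φ → satisfies A Φ ∧ satisfies B Φ) (allInstances k n m) ≤ count (hitsAgreement A B) (allClauses k n) ^ m
    count-satisfiedByBoth A B = ≤-trans
      (count-mono _ (all (hitsAgreement A B) ∘ toList) bothHit (allInstances k n m))
      (≤-reflexive (count-all-vecsOver (allClauses k n) (hitsAgreement A B) m))
      where
      bothHit : ∀ Φ → (satisfies A Φ ∧ satisfies B Φ) ≡ true → all (hitsAgreement A B) (toList Φ) ≡ true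
      bothHit Φ sat = all-mono₂ (satClause A) (satClause B) (hitsAgreement A B) (satClause⇒hitsAgreement 3≤k A B)
                                (toList Φ) (∧-conicalˡ _ _ sat) (∧-conicalʳ _ _ sat)

    module _ (q : ℚ) (T : ℕ)
             (rare : ∀ (A B : Assignment n) → overlapOf A B <ℚ q →
                     count (hitsAgreement {k = k} A B) (allClauses k n) * T ≤ length (allClauses k n)) where

      private
        I : List (Instance k n m)
        I = allInstances k n m

      closePair : Assignment n → Assignment n → Instance k n m → Bool
      closePair A B Φ = satisfies A Φ ∧ satisfies B Φ ∧ isYes (overlapOf A B <ℚ? q)

      count-closePair : ∀ A B → count (closePair A B) I * T ^ m ≤ length (allClauses k n) ^ m
      count-closePair A B = byCloseness (isYes (overlapOf A B <ℚ? q)) refl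
        where
        open ≤-Reasoning
        byCloseness : ∀ c → isYes (overlapOf A B <ℚ? q) ≡ c →
                      count (closePair A B) I * T ^ m ≤ length (allClauses k n) ^ m
        byCloseness false far =
          ≤-trans (*-monoˡ-≤ (T ^ m) (≤-trans (count-mono _ _ notClose I) (≤-reflexive (count-false I)))) z≤n
          where
          notClose : ∀ Φ → closePair A B Φ ≡ true → false ≡ true
          notClose Φ pair = trans (sym far) (∧-conicalʳ (satisfies B Φ) _ (∧-conicalʳ (satisfies A Φ) _ pair))
        byCloseness true close = begin
          count (closePair A B) I * T ^ m
            ≤⟨ *-monoˡ-≤ (T ^ m) (count-mono (closePair A B) _ bothSatisfied I) ⟩
          count (λ Φ → satisfies A Φ ∧ satisfies B Φ) I * T ^ m
            ≤⟨ *-monoˡ-≤ (T ^ m) (count-satisfiedByBoth A B) ⟩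
          count (hitsAgreement A B) (allClauses k n) ^ m * T ^ m
            ≡⟨ ^-distribʳ-* _ T m ⟨
          (count (hitsAgreement A B) (allClauses k n) * T) ^ m
            ≤⟨ ^-monoˡ-≤ m (rare A B (toWitness (Equivalence.from T-≡ close))) ⟩
          length (allClauses k n) ^ m ∎
          where
          bothSatisfied : ∀ Φ → closePair A B Φ ≡ true → (satisfies A Φ ∧ satisfies B Φ) ≡ true
          bothSatisfied Φ pair with satisfies A Φ | satisfies B Φ | pair
          ... | true | true | _ = refl

      firstMomentBound : count (hasClosePair q) I * T ^ m ≤ 2 ^ n * (2 ^ n * length I)
      firstMomentBound = begin
        count (hasClosePair q) I * T ^ m
          ≤⟨ *-monoˡ-≤ (T ^ m) unionBound ⟩
        sum (map (λ A → sum (map (λ B → count (closePair A B) I) Asg)) Asg) * T ^ m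
          ≤⟨ sum-*ʳ-≤ _ (T ^ m) _ (λ A → sum-*ʳ-≤ _ (T ^ m) _ (count-closePair A) Asg) Asg ⟩
        length Asg * (length Asg * length (allClauses k n) ^ m)
          ≡⟨ cong₂ (λ a c → a * (a * c)) (length-allAssignments n) (sym (length-vecsOver (allClauses k n) m)) ⟩
        2 ^ n * (2 ^ n * length I) ∎
        where
        open ≤-Reasoning
        Asg = allAssignments n
        unionBound : count (hasClosePair q) I ≤ sum (map (λ A → sum (map (λ B → count (closePair A B) I) Asg)) Asg)
        unionBound = ≤-trans (count-any (λ Φ A → any (λ B → closePair A B Φ) Asg) Asg I)
                             (sum-mono _ _ (λ A → count-any (λ Φ B → closePair A B Φ) Asg I) Asg)

  n≤2^n : ∀ n → n ≤ 2 ^ n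
  n≤2^n zero    = z≤n
  n≤2^n (suc n) = +-mono-≤ (m^n>0 2 n) (≤-trans (n≤2^n n) (m≤m+n (2 ^ n) 0))

  -- With n ≤ (m + 1) b, the 3bm available factors of 2 beat 2n + L once 3b + L ≤ n.
  2^n*2^n*L≤8^b^m : ∀ {n} m b L → n ≤ suc m * b → 3 * b + L ≤ n → 2 ^ n * 2 ^ n * L ≤ (2 ^ (3 * b)) ^ m
  2^n*2^n*L≤8^b^m {n} m b L n≤[m+1]b 3b+L≤n = begin
    2 ^ n * 2 ^ n * L       ≤⟨ *-monoʳ-≤ (2 ^ n * 2 ^ n) (n≤2^n L) ⟩
    2 ^ n * 2 ^ n * 2 ^ L   ≡⟨ cong (_* 2 ^ L) (^-distribˡ-+-* 2 n n) ⟨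
    2 ^ (n + n) * 2 ^ L     ≡⟨ ^-distribˡ-+-* 2 (n + n) L ⟨
    2 ^ (n + n + L)         ≤⟨ ^-monoʳ-≤ 2 2n+L≤3bm ⟩
    2 ^ (3 * b * m)         ≡⟨ ^-*-assoc 2 (3 * b) m ⟨
    (2 ^ (3 * b)) ^ m       ∎
    where
    open ≤-Reasoning
    2n+L≤3bm : n + n + L ≤ 3 * b * m
    2n+L≤3bm = +-cancelʳ-≤ (3 * b) _ _ (begin
      n + n + L + 3 * b       ≡⟨ shuffle n L b ⟩
      n + n + (3 * b + L)     ≤⟨ +-monoʳ-≤ (n + n) 3b+L≤n ⟩
      n + n + n               ≡⟨ triple n ⟩
      3 * n                   ≤⟨ *-monoʳ-≤ 3 n≤[m+1]b ⟩
      3 * (suc m * b)         ≡⟨ expand m b ⟩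
      3 * b * m + 3 * b       ∎)
      where
      shuffle : ∀ n L b → n + n + L + 3 * b ≡ n + n + (3 * b + L)
      shuffle = solve-∀
      triple : ∀ n → n + n + n ≡ 3 * n
      triple = solve-∀
      expand : ∀ m b → 3 * (suc m * b) ≡ 3 * b * m + 3 * b
      expand = solve-∀

  module _ {k n m b L : ℕ} (3≤k : 3 ≤ k) (2k²≤n : 2 * k * k ≤ n) (3b+L≤n : 3 * b + L ≤ n)
           (n≤[m+1]b : n ≤ suc m * b) (q : ℚ)
           (close : ∀ (A B : Assignment n) → overlapOf A B <ℚ q → agree A B * (2 * k * 2 ^ (3 * b)) < n) where

    count-hasClosePair*L≤total : count (hasClosePair q) (allInstances k n m) * L ≤ length (allInstances k n m)
    count-hasClosePair*L≤total = *-cancelˡ-≤ (2 ^ n * 2 ^ n) {{4^n≢0}} (begin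
      2 ^ n * 2 ^ n * (bad * L)        ≡⟨ swap (2 ^ n * 2 ^ n) bad L ⟩
      bad * (2 ^ n * 2 ^ n * L)        ≤⟨ *-monoʳ-≤ bad (2^n*2^n*L≤8^b^m m b L n≤[m+1]b 3b+L≤n) ⟩
      bad * (2 ^ (3 * b)) ^ m          ≤⟨ firstMomentBound {m = m} 3≤k q (2 ^ (3 * b)) rare ⟩
      2 ^ n * (2 ^ n * total)          ≡⟨ *-assoc (2 ^ n) (2 ^ n) total ⟨
      2 ^ n * 2 ^ n * total            ∎)
      where
      open ≤-Reasoning
      bad = count (hasClosePair q) (allInstances k n m)
      total = length (allInstances k n m)
      4^n≢0 : NonZero (2 ^ n * 2 ^ n)
      4^n≢0 = m*n≢0 (2 ^ n) (2 ^ n) {{m^n≢0 2 n}} {{m^n≢0 2 n}}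
      swap : ∀ P x L → P * (x * L) ≡ x * (P * L)
      swap = solve-∀
      rare : ∀ A B → overlapOf A B <ℚ q →
             count (hitsAgreement {k = k} A B) (allClauses k n) * 2 ^ (3 * b) ≤ length (allClauses k n)
      rare A B near = hitsAgreement-rare n (≤-trans (s≤s z≤n) 3≤k) 2k²≤n (2 ^ (3 * b)) A B (close A B near)

module RationalBounds where

  open import Data.Integer as ℤ using (+_; +[1+_]; +≤+; +<+)
  import Data.Integer.Properties as ℤP
  open import Data.Integer.DivMod using (n<s[n/ℕd]*d; div-pos-is-/ℕ)
  open import Data.Nat as ℕ using (ℕ; suc)
  import Data.Nat.Properties as ℕP
  open import Data.Rational as ℚ using (mkℚ; 0ℚ; 1ℚ; _/_; toℚᵘ; floor)
  import Data.Rational.Properties as ℚP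
  open import Data.Rational.Unnormalised as ℚᵘ using (mkℚᵘ; *≤*; *<*)
  import Data.Rational.Unnormalised.Properties as ℚᵘP
  open import Data.Product using (Σ; _,_)
  open import Relation.Binary.PropositionalEquality

  toℚᵘ-/suc : ∀ i n → toℚᵘ (i / suc n) ℚᵘ.≃ mkℚᵘ i n
  toℚᵘ-/suc i n = ℚP.toℚᵘ-fromℚᵘ (mkℚᵘ i n)

  +*+≤+*+ : ∀ a b c d → a ℕ.* b ℕ.≤ c ℕ.* d → + a ℤ.* + b ℤ.≤ + c ℤ.* + d
  +*+≤+*+ a b c d h = subst₂ ℤ._≤_ (ℤP.pos-* a b) (ℤP.pos-* c d) (+≤+ h)

  +*+<+*+ : ∀ a b c d → a ℕ.* b ℕ.< c ℕ.* d → + a ℤ.* + b ℤ.< + c ℤ.* + d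
  +*+<+*+ a b c d h = subst₂ ℤ._<_ (ℤP.pos-* a b) (ℤP.pos-* c d) (+<+ h)

  +*+<+*+⁻¹ : ∀ a b c d → + a ℤ.* + b ℤ.< + c ℤ.* + d → a ℕ.* b ℕ.< c ℕ.* d
  +*+<+*+⁻¹ a b c d h = ℤP.drop‿+<+ (subst₂ ℤ._<_ (sym (ℤP.pos-* a b)) (sym (ℤP.pos-* c d)) h)

  +a/suc-<-+b/suc⁻¹ : ∀ {a b m n} → (+ a) / suc m ℚ.< (+ b) / suc n → a ℕ.* suc n ℕ.< b ℕ.* suc m
  +a/suc-<-+b/suc⁻¹ {a} {b} {m} {n} h
    with *<* lt ← ℚᵘP.<-respʳ-≃ (toℚᵘ-/suc (+ b) n)
                    (ℚᵘP.<-respˡ-≃ (toℚᵘ-/suc (+ a) m) (ℚP.toℚᵘ-mono-< h))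
    = +*+<+*+⁻¹ a (suc n) b (suc m) lt

  +a/suc-<-+b/suc : ∀ {a b m n} → a ℕ.* suc n ℕ.< b ℕ.* suc m → (+ a) / suc m ℚ.< (+ b) / suc n
  +a/suc-<-+b/suc {a} {b} {m} {n} h = ℚP.toℚᵘ-cancel-<
    (ℚᵘP.<-respʳ-≃ (ℚᵘP.≃-sym (toℚᵘ-/suc (+ b) n))
      (ℚᵘP.<-respˡ-≃ (ℚᵘP.≃-sym (toℚᵘ-/suc (+ a) m)) (*<* (+*+<+*+ a (suc n) b (suc m) h))))

  toℚᵘ-*-/1 : ∀ p i → toℚᵘ (p ℚ.* (i / 1)) ℚᵘ.≃ toℚᵘ p ℚᵘ.* mkℚᵘ i 0
  toℚᵘ-*-/1 p i = ℚᵘP.≃-trans (ℚP.toℚᵘ-homo-* p (i / 1)) (ℚᵘP.*-congˡ {toℚᵘ p} (toℚᵘ-/suc i 0))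

  floor-upper : ∀ p → toℚᵘ p ℚᵘ.< mkℚᵘ (ℤ.suc (floor p)) 0
  floor-upper (mkℚ i d _) = *<* (subst₂ ℤ._<_ (sym (ℤP.*-identityʳ i))
    (cong (λ f → ℤ.suc f ℤ.* + suc d) (sym (div-pos-is-/ℕ i (suc d)))) (n<s[n/ℕd]*d i (suc d)))

  +n<i⇒n<∣i∣ : ∀ {n i} → + n ℤ.< i → n ℕ.< ℤ.∣ i ∣
  +n<i⇒n<∣i∣ (+<+ n<m) = n<m

  -- Writing c = (1 + a) / b, the bound n/b ≤ c n < ⌊c n⌋ + 1 gives n < (⌊c n⌋ + 1) b.
  numClauses-linear : ∀ c → 0ℚ ℚ.< c → Σ ℕ λ b → ∀ n → n ℕ.≤ suc (numClauses c n) ℕ.* b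
  numClauses-linear (mkℚ (+ 0)      _  _)  (ℚ.*<* (+<+ ()))
  numClauses-linear (mkℚ +[1+ a ]   b′ cp) _ = suc b′ , bound
    where
    c = mkℚ +[1+ a ] b′ cp
    bound : ∀ n → n ℕ.≤ suc (numClauses c n) ℕ.* suc b′
    bound n = ℕP.<⇒≤ (ℕP.<-≤-trans (+n<i⇒n<∣i∣ n<[⌊cn⌋+1]b) ∣[⌊cn⌋+1]b∣≤)
      where
      f = floor (c ℚ.* ((+ n) / 1))
      n/b≤cn : mkℚᵘ (+ n) b′ ℚᵘ.≤ toℚᵘ (c ℚ.* ((+ n) / 1))
      n/b≤cn = ℚᵘP.≤-respʳ-≃ (ℚᵘP.≃-sym (toℚᵘ-*-/1 c (+ n)))
        (*≤* (subst (λ z → + n ℤ.* + suc (b′ ℕ.* 1) ℤ.≤ z ℤ.* + suc b′) (ℤP.pos-* (suc a) n)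
               (+*+≤+*+ n (suc (b′ ℕ.* 1)) (suc a ℕ.* n) (suc b′)
                 (subst (λ d → n ℕ.* suc d ℕ.≤ suc a ℕ.* n ℕ.* suc b′) (sym (ℕP.*-identityʳ b′))
                   (ℕP.*-monoˡ-≤ (suc b′) (ℕP.m≤m+n n (a ℕ.* n)))))))
      n<[⌊cn⌋+1]b : + n ℤ.< ℤ.suc f ℤ.* + suc b′
      n<[⌊cn⌋+1]b with *<* lt ← ℚᵘP.≤-<-trans n/b≤cn (floor-upper (c ℚ.* ((+ n) / 1)))
        = subst (ℤ._< ℤ.suc f ℤ.* + suc b′) (ℤP.*-identityʳ (+ n)) lt
      ∣[⌊cn⌋+1]b∣≤ : ℤ.∣ ℤ.suc f ℤ.* + suc b′ ∣ ℕ.≤ suc ℤ.∣ f ∣ ℕ.* suc b′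
      ∣[⌊cn⌋+1]b∣≤ = ℕP.≤-trans (ℕP.≤-reflexive (ℤP.abs-* (ℤ.suc f) (+ suc b′)))
                               (ℕP.*-monoˡ-≤ (suc b′) (ℤP.∣i+j∣≤∣i∣+∣j∣ (+ 1) f))

  -- ε ≥ 1 / (1 + d) when ε = (1 + e) / (1 + d).
  fromℕ-≤-ε* : ∀ ε → 0ℚ ℚ.< ε → Σ ℕ λ L → ∀ x y → x ℕ.* L ℕ.≤ y → (+ x) / 1 ℚ.≤ ε ℚ.* ((+ y) / 1)
  fromℕ-≤-ε* (mkℚ (+ 0)    _ _)  (ℚ.*<* (+<+ ()))
  fromℕ-≤-ε* (mkℚ +[1+ e ] d cp) _ = suc d , bound
    where
    ε = mkℚ +[1+ e ] d cp
    bound : ∀ x y → x ℕ.* suc d ℕ.≤ y → (+ x) / 1 ℚ.≤ ε ℚ.* ((+ y) / 1)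
    bound x y xL≤y = ℚP.toℚᵘ-cancel-≤ (ℚᵘP.≤-respʳ-≃ (ℚᵘP.≃-sym (toℚᵘ-*-/1 ε (+ y)))
      (ℚᵘP.≤-respˡ-≃ (ℚᵘP.≃-sym (toℚᵘ-/suc (+ x) 0))
        (*≤* (subst (λ z → + x ℤ.* + suc (d ℕ.* 1) ℤ.≤ z ℤ.* + 1) (ℤP.pos-* (suc e) y)
               (+*+≤+*+ x (suc (d ℕ.* 1)) (suc e ℕ.* y) 1
                 (subst₂ ℕ._≤_ (cong (λ d′ → x ℕ.* suc d′) (sym (ℕP.*-identityʳ d))) (sym (ℕP.*-identityʳ _))
                   (ℕP.≤-trans xL≤y (ℕP.m≤m+n y (e ℕ.* y)))))))))

  0<1/[2+R] : ∀ R → 0ℚ ℚ.< (+ 1) / (2 ℕ.+ R)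
  0<1/[2+R] R = +a/suc-<-+b/suc {0} {1} {0} {suc R} (ℕ.s≤s ℕ.z≤n)

  1/[2+R]<1 : ∀ R → (+ 1) / (2 ℕ.+ R) ℚ.< 1ℚ
  1/[2+R]<1 R = +a/suc-<-+b/suc {1} {1} {suc R} {0} (ℕ.s≤s (ℕ.s≤s ℕ.z≤n))

  overlap<1/[2+R]⇒agree*R<n : ∀ {n R} (A B : Assignment (suc n)) → overlapOf A B ℚ.< (+ 1) / (2 ℕ.+ R) →
                               agree A B ℕ.* R ℕ.< suc n
  overlap<1/[2+R]⇒agree*R<n {n} {R} A B close = ℕP.≤-<-trans (ℕP.*-monoʳ-≤ (agree A B) (ℕP.m≤n+m R 2))
    (subst (agree A B ℕ.* (2 ℕ.+ R) ℕ.<_) (ℕP.*-identityˡ (suc n))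
           (+a/suc-<-+b/suc⁻¹ {agree A B} {1} {n} {suc R} close))

open import Data.Nat using (ℕ; _≤_)
open import Data.Product using (Σ; _×_)
open import Data.Integer using (+_)
open import Data.Rational using (ℚ; 0ℚ; 1ℚ; _/_; _*_) renaming (_<_ to _<ℚ_; _≤_ to _≤ℚ_)

open import Data.Nat as ℕ using (suc; s≤s; _^_)
import Data.Nat.Properties as ℕP
open import Data.Product using (_,_; proj₁; proj₂)
open FirstMoment
open RationalBounds

theorem3 : (k : ℕ) → 3 ≤ k → (c : ℚ) → 0ℚ <ℚ c →
    Σ ℚ (λ q → (0ℚ <ℚ q × q <ℚ 1ℚ) ×
    ((ε : ℚ) → 0ℚ <ℚ ε → Σ ℕ (λ N → (n : ℕ) → N ≤ n →
    ((+ badCount k n c q) / 1) ≤ℚ ε * ((+ totalCount k n c) / 1))))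
theorem3 k 3≤k c 0<c = q , (0<1/[2+R] R , 1/[2+R]<1 R) , eventually
  where
  b = proj₁ (numClauses-linear c 0<c)
  linear = proj₂ (numClauses-linear c 0<c)
  R = 2 ℕ.* k ℕ.* 2 ^ (3 ℕ.* b)
  q = (+ 1) / (2 ℕ.+ R)
  eventually : (ε : ℚ) → 0ℚ <ℚ ε → Σ ℕ (λ N → (n : ℕ) → N ≤ n →
                 ((+ badCount k n c q) / 1) ≤ℚ ε * ((+ totalCount k n c) / 1))
  eventually ε 0<ε = N , bound
    where
    L = proj₁ (fromℕ-≤-ε* ε 0<ε)
    ≤ε* = proj₂ (fromℕ-≤-ε* ε 0<ε)
    N = suc (2 ℕ.* k ℕ.* k ℕ.+ (3 ℕ.* b ℕ.+ L))
    bound : (n : ℕ) → N ≤ n → ((+ badCount k n c q) / 1) ≤ℚ ε * ((+ totalCount k n c) / 1)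
    bound (suc n) (s≤s N≤n) = ≤ε* (badCount k (suc n) c q) (totalCount k (suc n) c)
      (count-hasClosePair*L≤total {m = numClauses c (suc n)} {b} {L} 3≤k 2k²≤n 3b+L≤n (linear (suc n)) q
                                  overlap<1/[2+R]⇒agree*R<n)
      where
      2k²≤n : 2 ℕ.* k ℕ.* k ≤ suc n
      2k²≤n = ℕP.≤-trans (ℕP.m≤m+n _ _) (ℕP.m≤n⇒m≤1+n N≤n)
      3b+L≤n : 3 ℕ.* b ℕ.+ L ≤ suc n
      3b+L≤n = ℕP.≤-trans (ℕP.m≤n+m _ (2 ℕ.* k ℕ.* k)) (ℕP.m≤n⇒m≤1+n N≤n)
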